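{- Let $D$ be a block design with parameters $(v,b,r,k,\lambda)$ built on a finite set $V$ with $k<v-1$. Then $D$ is friends with the full design $\mathcal D_{v-1}$ on $V$.
   Context: A block design with parameters $(v,b,r,k,\lambda)$ built on a finite set $V$ ($|V|=v$) is a list of $b$ blocks, each a $k$-subset of $V$, such that every element lies in exactly $r$ blocks and every pair of distinct elements lies in exactly $\lambda$ blocks; designs are simple. The full design $\mathcal D_k$ on $V$ is the design whose blocks are all $k$-element subsets of $V$. For a design $D$ with blocks $B_1,\dots,B_b$ and $M\subseteq V$, $\varphi(D,M)=(z_0,\dots,z_k)$ where $z_j$ is the number of $s$ with $|M\cap B_s|=j$. Two designs $D_1,D_2$ on $V$ are friends if $\varphi(D_1,D_2^i)$ is independent of the block $D_2^i$ of $D_2$ and $\varphi(D_2,D_1^j)$ is independent of the block $D_1^j$ of $D_1$. -}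

module Defs where

open import Data.Nat using (ℕ; zero; suc; _≟_)
open import Data.Bool using (true; false)
open import Data.Fin using (Fin)
open import Data.Fin.Subset using (Subset; _∈_; _∩_; ∣_∣)
open import Data.Fin.Subset.Properties using (_∈?_)
open import Data.Vec using (Vec; []; _∷_; tabulate)
open import Data.List using (List; []; _∷_; _++_; map; filter; length)
open import Data.List.Relation.Unary.Unique.Propositional using (Unique)
open import Data.List.Relation.Unary.All using (All)
open import Data.List.Membership.Propositional renaming (_∈_ to _∈ₗ_)
open import Data.Product using (_×_)
open import Relation.Nullary.Decidable using (_×-dec_)
open import Relation.Binary.PropositionalEquality using (_≡_; _≢_)
open import Data.Fin using (toℕ)

allSubsets : (n : ℕ) → List (Subset n)
allSubsets zero = [] ∷ []
allSubsets (suc n) = map (true ∷_) (allSubsets n) ++ map (false ∷_) (allSubsets n)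

Design : ℕ → Set
Design v = List (Subset v)

repl : ∀ {v} → Design v → Fin v → ℕ
repl D x = length (filter (λ B → x ∈? B) D)

pairCount : ∀ {v} → Design v → Fin v → Fin v → ℕ
pairCount D x y = length (filter (λ B → (x ∈? B) ×-dec (y ∈? B)) D)

IsBlockDesign : (v b r k λ' : ℕ) → Design v → Set
IsBlockDesign v b r k λ' D =
  length D ≡ b
  × All (λ B → ∣ B ∣ ≡ k) D
  × (∀ (x : Fin v) → repl D x ≡ r)
  × (∀ (x y : Fin v) → x ≢ y → pairCount D x y ≡ λ')
  × Unique D

fullDesign : (v k : ℕ) → Design v
fullDesign v k = filter (λ B → ∣ B ∣ ≟ k) (allSubsets v)

φ : ∀ {v} (k : ℕ) → Design v → Subset v → Vec ℕ (suc k)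
φ k D M = tabulate (λ (j : Fin (suc k)) → length (filter (λ B → ∣ M ∩ B ∣ ≟ toℕ j) D))

φConstantOn : ∀ {v} (k : ℕ) → Design v → Design v → Set
φConstantOn k D E = ∀ {M M'} → M ∈ₗ E → M' ∈ₗ E → φ k D M ≡ φ k D M'

Friends : ∀ {v} (k₁ k₂ : ℕ) → Design v → Design v → Set
Friends k₁ k₂ D₁ D₂ = φConstantOn k₁ D₁ D₂ × φConstantOn k₂ D₂ D₁

module Submission where

-- The (v-1)-subsets of V are exactly the complements V ∖ {x} of points, and
-- intersecting a set p with V ∖ {x} loses one element if x ∈ p and none
-- otherwise.  So in both directions the intersection sizes take only the two
-- values k-1 and k (resp. |B|-1 and |B|), and the profile φ is determined by
-- how many items reach the lower value:
--   * φ(D, V ∖ {x}) has r = #{blocks ∋ x} at level k-1 and b - r at level k;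
--   * φ(𝒟_{v-1}, B) has |B| = k at level k-1 and v - k at level k.
-- Neither depends on the chosen block, which is the friendship property.

open import Defs
open import Data.Nat using (ℕ; zero; suc; _+_; _∸_; _<_; _≟_)
open import Data.Nat.Properties
  using (suc-injective; +-suc; m+n∸m≡n; 1+n≢n; <⇒≢; ≤-<-trans; ≤-refl)
open import Data.Bool using (true; false; if_then_else_)
open import Data.Fin using (Fin; toℕ) renaming (zero to fzero; suc to fsuc)
open import Data.Fin.Subset using (Subset; _∈_; _∉_; _∩_; ∣_∣; ∁; ⁅_⁆; ⊤; ⊥; inside; outside)
open import Data.Fin.Subset.Properties using (_∈?_; ∣p∣≤n; ∩-comm; ∩-identityˡ; drop-there)
open import Data.Vec using ([]; _∷_; here; there)
import Data.Vec as Vec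
import Data.Vec.Properties as Vec
open import Data.List using (List; []; _∷_; [_]; _++_; map; filter; length; tabulate; allFin)
open import Data.List.Properties using (length-map; length-tabulate; map-tabulate; filter-++; filter-none; filter-≐)
open import Data.List.Relation.Unary.All as All using (All; []; _∷_)
open import Data.List.Relation.Binary.Permutation.Propositional using (_↭_; ↭-refl; module PermutationReasoning)
open import Data.List.Relation.Binary.Permutation.Propositional.Properties
  using (filter-↭; ↭-length; map⁺; ++-comm; ∈-resp-↭)
open import Data.List.Membership.Propositional using () renaming (_∈_ to _∈ₗ_)
open import Data.List.Membership.Propositional.Properties using (∈-tabulate⁻)
open import Data.Product using (_×_; _,_; proj₁; proj₂; ∃)
open import Data.Empty using (⊥-elim)
open import Function using (_∘_; _⇔_; mk⇔)
open import Function.Bundles using (Equivalence)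
open import Relation.Nullary using (yes; no; does; ¬_; contradiction)
open import Relation.Nullary.Decidable using (dec-true; dec-false)
open import Relation.Unary using (Decidable)
open import Relation.Unary.Properties using (∁?)
open import Relation.Binary.PropositionalEquality using (_≡_; _≢_; refl; sym; trans; cong; cong₂; subst; module ≡-Reasoning)

count : ∀ {A : Set} {P : A → Set} → Decidable P → List A → ℕ
count P? xs = length (filter P? xs)

module _ {A : Set} where

  filter-congᴬ : ∀ {P Q : A → Set} (P? : Decidable P) (Q? : Decidable Q) {xs} →
    All (λ a → P a ⇔ Q a) xs → filter P? xs ≡ filter Q? xs
  filter-congᴬ P? Q? [] = refl
  filter-congᴬ P? Q? {x ∷ _} (P⇔Q ∷ rest) with P? x | Q? x
  ... | yes _  | yes _  = cong (x ∷_) (filter-congᴬ P? Q? rest)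
  ... | yes p  | no ¬q  = contradiction (Equivalence.to P⇔Q p) ¬q
  ... | no ¬p  | yes q  = contradiction (Equivalence.from P⇔Q q) ¬p
  ... | no _   | no _   = filter-congᴬ P? Q? rest

  count-complement : ∀ {P : A → Set} (P? : Decidable P) xs →
    count P? xs + count (∁? P?) xs ≡ length xs
  count-complement P? [] = refl
  count-complement P? (x ∷ xs) with P? x
  ... | yes _ = cong suc (count-complement P? xs)
  ... | no _  = trans (+-suc (count P? xs) _) (cong suc (count-complement P? xs))

  count-∁ : ∀ {P : A → Set} (P? : Decidable P) xs → count (∁? P?) xs ≡ length xs ∸ count P? xs
  count-∁ P? xs = trans (sym (m+n∸m≡n (count P? xs) _)) (cong (_∸ count P? xs) (count-complement P? xs))

  count-↭ : ∀ {P : A → Set} (P? : Decidable P) {xs ys} → xs ↭ ys → count P? xs ≡ count P? ys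
  count-↭ P? xs↭ys = ↭-length (filter-↭ P? xs↭ys)

  filter-map : ∀ {B : Set} {P : B → Set} (P? : Decidable P) (f : A → B) xs →
    filter P? (map f xs) ≡ map f (filter (P? ∘ f) xs)
  filter-map P? f [] = refl
  filter-map P? f (x ∷ xs) with does (P? (f x))
  ... | true  = cong (f x ∷_) (filter-map P? f xs)
  ... | false = filter-map P? f xs

count-tabulate : ∀ {n} {B : Set} {P : B → Set} (P? : Decidable P) (f : Fin n → B) →
  count P? (tabulate f) ≡ count (P? ∘ f) (allFin n)
count-tabulate P? f = begin
  count P? (tabulate f)                   ≡⟨ cong (count P?) (sym (map-tabulate (λ x → x) f)) ⟩
  length (filter P? (map f (allFin _)))   ≡⟨ cong length (filter-map P? f (allFin _)) ⟩
  length (map f (filter (P? ∘ f) (allFin _)))  ≡⟨ length-map f (filter (P? ∘ f) (allFin _)) ⟩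
  count (P? ∘ f) (allFin _)               ∎
  where open ≡-Reasoning

twoLevel : (k p q j : ℕ) → ℕ
twoLevel k p q j = if does (suc j ≟ k) then p else if does (j ≟ k) then q else 0

module _ {k p q j : ℕ} where

  twoLevel-lower : suc j ≡ k → twoLevel k p q j ≡ p
  twoLevel-lower j+1≡k = cong (λ c → if c then p else if does (j ≟ k) then q else 0) (dec-true (suc j ≟ k) j+1≡k)

  twoLevel-upper : suc j ≢ k → j ≡ k → twoLevel k p q j ≡ q
  twoLevel-upper j+1≢k j≡k = cong₂ (λ c c′ → if c then p else if c′ then q else 0)
    (dec-false (suc j ≟ k) j+1≢k) (dec-true (j ≟ k) j≡k)

  twoLevel-other : suc j ≢ k → j ≢ k → twoLevel k p q j ≡ 0
  twoLevel-other j+1≢k j≢k = cong₂ (λ c c′ → if c then p else if c′ then q else 0)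
    (dec-false (suc j ≟ k) j+1≢k) (dec-false (j ≟ k) j≢k)

Splits : {A : Set} → (A → Set) → (A → ℕ) → ℕ → A → Set
Splits T s k a = (T a → suc (s a) ≡ k) × (¬ T a → s a ≡ k)

count-twoLevel : ∀ {A : Set} {T : A → Set} (T? : Decidable T) (s : A → ℕ) (k : ℕ) {xs} →
  All (Splits T s k) xs → ∀ j →
  count (λ a → s a ≟ j) xs ≡ twoLevel k (count T? xs) (count (∁? T?) xs) j
count-twoLevel {T = T} T? s k splits j with suc j ≟ k
... | yes j+1≡k = trans (cong length (filter-congᴬ _ T? (All.map lower splits))) (sym (twoLevel-lower j+1≡k))
  where
  lower : ∀ {a} → Splits T s k a → (s a ≡ j) ⇔ T a
  lower {a} (onT , offT) = mk⇔ toT (λ t → suc-injective (trans (onT t) (sym j+1≡k)))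
    where
    toT : s a ≡ j → T a
    toT sa≡j with T? a
    ... | yes t  = t
    ... | no ¬t  = contradiction (trans j+1≡k (trans (sym (offT ¬t)) sa≡j)) 1+n≢n
... | no j+1≢k with j ≟ k
...   | yes j≡k =
  trans (cong length (filter-congᴬ _ (∁? T?) (All.map upper splits))) (sym (twoLevel-upper j+1≢k j≡k))
  where
  upper : ∀ {a} → Splits T s k a → (s a ≡ j) ⇔ (¬ T a)
  upper (onT , offT) = mk⇔ (λ sa≡j t → 1+n≢n (trans (onT t) (trans (sym j≡k) (sym sa≡j))))
                           (λ ¬t → trans (offT ¬t) (sym j≡k))
...   | no j≢k = trans (cong length (filter-none _ (All.map neither splits))) (sym (twoLevel-other j+1≢k j≢k))
  where
  neither : ∀ {a} → Splits T s k a → s a ≢ j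
  neither {a} (onT , offT) sa≡j with T? a
  ... | yes t  = j+1≢k (trans (cong suc (sym sa≡j)) (onT t))
  ... | no ¬t  = j≢k (trans (sym sa≡j) (offT ¬t))

∁⊥≡⊤ : ∀ {n} → ∁ (⊥ {n}) ≡ ⊤
∁⊥≡⊤ {zero}  = refl
∁⊥≡⊤ {suc n} = cong (inside ∷_) ∁⊥≡⊤

∁⊥∩p≡p : ∀ {n} (p : Subset n) → ∁ ⊥ ∩ p ≡ p
∁⊥∩p≡p p = trans (cong (_∩ p) ∁⊥≡⊤) (∩-identityˡ p)

removePoint : ∀ {n} (x : Fin n) (p : Subset n) →
  (x ∈ p → suc ∣ ∁ ⁅ x ⁆ ∩ p ∣ ≡ ∣ p ∣) × (x ∉ p → ∣ ∁ ⁅ x ⁆ ∩ p ∣ ≡ ∣ p ∣)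
removePoint fzero (inside ∷ p)  = (λ _ → cong (suc ∘ ∣_∣) (∁⊥∩p≡p p)) , (λ 0∉ → ⊥-elim (0∉ here))
removePoint fzero (outside ∷ p) = (λ ()) , (λ _ → cong ∣_∣ (∁⊥∩p≡p p))
removePoint (fsuc x) (inside ∷ p) =
  (λ { (there x∈p) → cong suc (proj₁ (removePoint x p) x∈p) }) ,
  (λ x∉ → cong suc (proj₂ (removePoint x p) (x∉ ∘ there)))
removePoint (fsuc x) (outside ∷ p) =
  (λ { (there x∈p) → proj₁ (removePoint x p) x∈p }) ,
  (λ x∉ → proj₂ (removePoint x p) (x∉ ∘ there))

count-∈-tail : ∀ {n} b (p : Subset n) → count (_∈? b ∷ p) (tabulate fsuc) ≡ count (_∈? p) (allFin n)
count-∈-tail {n} b p = begin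
  count (_∈? b ∷ p) (tabulate fsuc)          ≡⟨ count-tabulate (_∈? b ∷ p) fsuc ⟩
  count (λ x → fsuc x ∈? b ∷ p) (allFin n)   ≡⟨ cong length (filter-≐ _ (_∈? p) (drop-there , there) (allFin n)) ⟩
  count (_∈? p) (allFin n)                   ∎
  where open ≡-Reasoning

count-∈ : ∀ {n} (p : Subset n) → count (_∈? p) (allFin n) ≡ ∣ p ∣
count-∈ []            = refl
count-∈ (inside ∷ p)  = cong suc (trans (count-∈-tail inside p) (count-∈ p))
count-∈ (outside ∷ p) = trans (count-∈-tail outside p) (count-∈ p)

-- Pascal recursion: a (k+1)-subset of Fin (n+1) either contains the first
-- point (and is a k-subset of the rest) or not (and is a (k+1)-subset of it).
fullDesign-pascal : ∀ n k →
  fullDesign (suc n) (suc k) ≡ map (inside ∷_) (fullDesign n k) ++ map (outside ∷_) (fullDesign n (suc k))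
fullDesign-pascal n k = begin
  filter P? (map (inside ∷_) A ++ map (outside ∷_) A)
    ≡⟨ filter-++ P? (map (inside ∷_) A) (map (outside ∷_) A) ⟩
  filter P? (map (inside ∷_) A) ++ filter P? (map (outside ∷_) A)
    ≡⟨ cong₂ _++_ (filter-map P? (inside ∷_) A) (filter-map P? (outside ∷_) A) ⟩
  map (inside ∷_) (filter (λ B → suc ∣ B ∣ ≟ suc k) A) ++ map (outside ∷_) (fullDesign n (suc k))
    ≡⟨ cong (λ F → map (inside ∷_) F ++ map (outside ∷_) (fullDesign n (suc k))) (filter-≐ _ _ (suc-injective , cong suc) A) ⟩
  map (inside ∷_) (fullDesign n k) ++ map (outside ∷_) (fullDesign n (suc k)) ∎
  where
  open ≡-Reasoning
  A : List (Subset n)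
  A = allSubsets n
  P? : Decidable (λ (B : Subset (suc n)) → ∣ B ∣ ≡ suc k)
  P? B = ∣ B ∣ ≟ suc k

fullDesign-empty : ∀ n k → n < k → fullDesign n k ≡ []
fullDesign-empty n k n<k =
  filter-none _ (All.universal (λ B → <⇒≢ (≤-<-trans (∣p∣≤n B) n<k)) (allSubsets n))

fullDesign-top : ∀ n → fullDesign n n ≡ [ ⊤ ]
fullDesign-top zero    = refl
fullDesign-top (suc n) = trans (fullDesign-pascal n n)
  (cong₂ (λ F G → map (inside ∷_) F ++ map (outside ∷_) G) (fullDesign-top n) (fullDesign-empty n (suc n) ≤-refl))

pointComplements : (n : ℕ) → List (Subset n)
pointComplements n = tabulate (λ x → ∁ ⁅ x ⁆)

fullDesign-pointComplements : ∀ n → fullDesign (suc n) n ↭ pointComplements (suc n)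
fullDesign-pointComplements zero    = ↭-refl
fullDesign-pointComplements (suc m) = begin
  fullDesign (suc (suc m)) (suc m)
    ≡⟨ fullDesign-pascal (suc m) m ⟩
  map (inside ∷_) (fullDesign (suc m) m) ++ map (outside ∷_) (fullDesign (suc m) (suc m))
    ≡⟨ cong (λ G → map (inside ∷_) (fullDesign (suc m) m) ++ map (outside ∷_) G) (fullDesign-top (suc m)) ⟩
  map (inside ∷_) (fullDesign (suc m) m) ++ [ outside ∷ ⊤ ]
    ↭⟨ ++-comm (map (inside ∷_) (fullDesign (suc m) m)) [ outside ∷ ⊤ ] ⟩
  (outside ∷ ⊤) ∷ map (inside ∷_) (fullDesign (suc m) m)
    <⟨ map⁺ (inside ∷_) (fullDesign-pointComplements m) ⟩
  (outside ∷ ⊤) ∷ map (inside ∷_) (pointComplements (suc m))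
    ≡⟨ cong₂ _∷_ (cong (outside ∷_) (sym ∁⊥≡⊤)) (map-tabulate (λ x → ∁ ⁅ x ⁆) (inside ∷_)) ⟩
  pointComplements (suc (suc m)) ∎
  where open PermutationReasoning

fullDesign-member : ∀ {n M} → M ∈ₗ fullDesign (suc n) n → ∃ λ x → M ≡ ∁ ⁅ x ⁆
fullDesign-member {n} M∈ = ∈-tabulate⁻ (∈-resp-↭ (fullDesign-pointComplements n) M∈)

φ-pointComplement : ∀ {v} k (D : Design v) (x : Fin v) → All (λ B → ∣ B ∣ ≡ k) D →
  φ k D (∁ ⁅ x ⁆) ≡ Vec.tabulate (λ j → twoLevel k (repl D x) (length D ∸ repl D x) (toℕ j))
φ-pointComplement k D x sizes = Vec.tabulate-cong λ j → begin
  count (λ B → ∣ ∁ ⁅ x ⁆ ∩ B ∣ ≟ toℕ j) D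
    ≡⟨ count-twoLevel (x ∈?_) (λ B → ∣ ∁ ⁅ x ⁆ ∩ B ∣) k (All.map splits sizes) (toℕ j) ⟩
  twoLevel k (repl D x) (count (∁? (x ∈?_)) D) (toℕ j)
    ≡⟨ cong (λ q → twoLevel k (repl D x) q (toℕ j)) (count-∁ (x ∈?_) D) ⟩
  twoLevel k (repl D x) (length D ∸ repl D x) (toℕ j) ∎
  where
  open ≡-Reasoning
  splits : ∀ {B} → ∣ B ∣ ≡ k → Splits (x ∈_) (λ B → ∣ ∁ ⁅ x ⁆ ∩ B ∣) k B
  splits {B} ∣B∣≡k = subst (λ m → Splits (x ∈_) (λ B → ∣ ∁ ⁅ x ⁆ ∩ B ∣) m B) ∣B∣≡k (removePoint x B)

φ-fullDesign : ∀ n (B : Subset (suc n)) →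
  φ n (fullDesign (suc n) n) B ≡ Vec.tabulate (λ j → twoLevel ∣ B ∣ (∣ B ∣) (suc n ∸ ∣ B ∣) (toℕ j))
φ-fullDesign n B = Vec.tabulate-cong λ j → begin
  count (λ M → ∣ B ∩ M ∣ ≟ toℕ j) (fullDesign (suc n) n)
    ≡⟨ count-↭ (λ M → ∣ B ∩ M ∣ ≟ toℕ j) (fullDesign-pointComplements n) ⟩
  count (λ M → ∣ B ∩ M ∣ ≟ toℕ j) (pointComplements (suc n))
    ≡⟨ count-tabulate (λ M → ∣ B ∩ M ∣ ≟ toℕ j) (λ y → ∁ ⁅ y ⁆) ⟩
  count (λ y → ∣ B ∩ ∁ ⁅ y ⁆ ∣ ≟ toℕ j) (allFin (suc n))
    ≡⟨ count-twoLevel (_∈? B) (λ y → ∣ B ∩ ∁ ⁅ y ⁆ ∣) size (All.universal splits (allFin (suc n))) (toℕ j) ⟩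
  twoLevel size (count (_∈? B) (allFin (suc n))) (count (∁? (_∈? B)) (allFin (suc n))) (toℕ j)
    ≡⟨ cong₂ (λ p q → twoLevel size p q (toℕ j)) (count-∈ B) (count-∁ (_∈? B) (allFin (suc n))) ⟩
  twoLevel size size (length (allFin (suc n)) ∸ count (_∈? B) (allFin (suc n))) (toℕ j)
    ≡⟨ cong₂ (λ m p → twoLevel size size (m ∸ p) (toℕ j)) (length-tabulate (λ y → y)) (count-∈ B) ⟩
  twoLevel size size (suc n ∸ size) (toℕ j) ∎
  where
  open ≡-Reasoning
  size : ℕ
  size = ∣ B ∣
  splits : ∀ y → Splits (_∈ B) (λ y → ∣ B ∩ ∁ ⁅ y ⁆ ∣) size y
  splits y = (λ y∈B → trans (cong (suc ∘ ∣_∣) (∩-comm B _)) (proj₁ (removePoint y B) y∈B))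
           , (λ y∉B → trans (cong ∣_∣ (∩-comm B _)) (proj₂ (removePoint y B) y∉B))

φConstantOn-intro : ∀ {v} k (D E : Design v) (c : Vec.Vec ℕ (suc k)) →
  (∀ {M} → M ∈ₗ E → φ k D M ≡ c) → φConstantOn k D E
φConstantOn-intro k D E c φ≡c M∈E M′∈E = trans (φ≡c M∈E) (sym (φ≡c M′∈E))

-- The theorem.
lemma2 : (v b r k λ' : ℕ) (D : Design v) → IsBlockDesign v b r k λ' D → k < v ∸ 1 →
    Friends k (v ∸ 1) D (fullDesign v (v ∸ 1))
lemma2 zero    _ _ _ _  _ _ ()
lemma2 (suc n) b r k λ' D (∣D∣≡b , sizes , reps , _) _ =
  φConstantOn-intro k D E _ φ-D-fixed , φConstantOn-intro n E D _ φ-full-fixed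
  where
  E : Design (suc n)
  E = fullDesign (suc n) n

  φ-D-fixed : ∀ {M} → M ∈ₗ E →
    φ k D M ≡ Vec.tabulate (λ j → twoLevel k r (b ∸ r) (toℕ j))
  φ-D-fixed M∈ with x , refl ← fullDesign-member M∈ =
    trans (φ-pointComplement k D x sizes)
          (cong₂ (λ r′ b′ → Vec.tabulate (λ j → twoLevel k r′ (b′ ∸ r′) (toℕ j))) (reps x) ∣D∣≡b)

  φ-full-fixed : ∀ {B} → B ∈ₗ D →
    φ n E B ≡ Vec.tabulate (λ j → twoLevel k k (suc n ∸ k) (toℕ j))
  φ-full-fixed {B} B∈D =
    trans (φ-fullDesign n B) (cong (λ m → Vec.tabulate (λ j → twoLevel m m (suc n ∸ m) (toℕ j))) (All.lookup sizes B∈D))
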